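{- Let $m_1,m_2$ be positive integers. For every point $(x_1,x_2)\in\mathcal{S}^2$, the step length $k(x_1,x_2)$ equals $2\,\mathrm{lcm}(m_1,m_2)$; in particular it does not depend on $(x_1,x_2)$.
   Context: $\mathcal{S}^2=\{(x_1,x_2)\in\mathbb{Z}^2: 0\le x_i\le m_i,\ i=1,2\}$. For a positive integer $m$ let $\varphi_m(u)=\min_{n\in\mathbb{Z}}|u-2nm|$ for $u\in\mathbb{Z}$ (the $2m$-periodic triangle wave with $\varphi_m(u)=u$ for $0\le u\le m$). For $k\in\mathbb{Z}$ put $f_i^k(x)=\varphi_{m_i}(x+k)$ and $F^k(x_1,x_2)=(f_1^k(x_1),f_2^k(x_2))$ (the position after $k$ steps of a light beam started at $(x_1,x_2)$ in direction $(+1,+1)$ reflecting in the boundary of $[0,m_1]\times[0,m_2]$); in particular $F^{ -1}(x_1,x_2)=(\varphi_{m_1}(x_1-1),\varphi_{m_2}(x_2-1))$. The step length $k(x_1,x_2)$ is the smallest positive integer $k$ such that $F^{k}(x_1,x_2)=(x_1,x_2)$ and $F^{k-1}(x_1,x_2)=F^{ -1}(x_1,x_2)$ (the closed path starting from $(x_1,x_2)$ is the chain $F^1,\dots,F^{k}$). -}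

module Defs where

open import Data.Nat using (ℕ; suc; NonZero; _⊓_; _≤_; _<_)
open import Data.Integer using (ℤ; +_; _+_; _-_; -_; ∣_∣; _*_)
open import Data.Integer.DivMod using (_%ℕ_)
open import Data.Product using (_×_; _,_)
open import Relation.Binary.PropositionalEquality using (_≡_)

-- φ_m(u) = min_{n ∈ ℤ} |u - 2nm|, the 2m-periodic triangle wave.
-- Computed as r ⊓ (2m - r) with r = u mod 2m ∈ [0, 2m); this is exactly
-- the minimum over n (the nearest multiples of 2m to u are u - r and u - r + 2m).
φ : (m : ℕ) → .{{NonZero m}} → ℤ → ℕ
φ m@(suc k) u = r ⊓ (2m Data.Nat.∸ r)
  where
  2m : ℕ
  2m = 2 Data.Nat.* m
  r : ℕ
  r = u %ℕ 2m

f : (m : ℕ) → .{{NonZero m}} → ℤ → ℕ → ℕ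
f m k x = φ m (+ x + k)

F : (m₁ m₂ : ℕ) → .{{NonZero m₁}} → .{{NonZero m₂}} → ℤ → ℕ × ℕ → ℕ × ℕ
F m₁ m₂ k (x₁ , x₂) = (f m₁ k x₁ , f m₂ k x₂)

InS2 : (m₁ m₂ : ℕ) → ℕ × ℕ → Set
InS2 m₁ m₂ (x₁ , x₂) = (x₁ ≤ m₁) × (x₂ ≤ m₂)

Closes : (m₁ m₂ : ℕ) → .{{NonZero m₁}} → .{{NonZero m₂}} → ℕ → ℕ × ℕ → Set
Closes m₁ m₂ k p =
  (F m₁ m₂ (+ k) p ≡ p) × (F m₁ m₂ (+ k - + 1) p ≡ F m₁ m₂ (- + 1) p)

IsStepLength : (m₁ m₂ : ℕ) → .{{NonZero m₁}} → .{{NonZero m₂}} → ℕ → ℕ × ℕ → Set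
IsStepLength m₁ m₂ k p =
  (0 < k) × Closes m₁ m₂ k p × (∀ j → 0 < j → Closes m₁ m₂ j p → k ≤ j)

{-# OPTIONS --safe #-}
module Submission where

-- In one coordinate φ_m is 2m-periodic, and for x ≤ m the equation φ_m(u) = x forces
-- u ≡ ±x (mod 2m).  The second closing condition φ_m(u − 1) = φ_m(x − 1) rules out
-- u ≡ −x ≢ x, since there the beam is moving towards 0 and came from x + 1.  So a
-- coordinate closes after k steps exactly when 2m ∣ k, the plane path exactly when
-- 2m₁ ∣ k and 2m₂ ∣ k, i.e. when 2 lcm(m₁, m₂) ∣ k.

open import Defs
open import Data.Nat using (ℕ; NonZero; _*_)
open import Data.Nat.LCM using (lcm; m∣lcm[m,n]; n∣lcm[m,n]; lcm-least; gcd*lcm)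
open import Data.Product using (_×_; _,_)

open import Data.Nat.Base
  using (zero; suc; _+_; _∸_; _⊓_; _≤_; _<_; _%_; _/_; z≤n; s≤s; z<s; >-nonZero; >-nonZero⁻¹)
open import Data.Nat.Properties
open import Data.Nat.DivMod using (m≡m%n+[m/n]*n; [m+kn]%n≡m%n; m<n⇒m%n≡m; m%n<n; m%n≤n)
open import Data.Nat.Divisibility
open import Data.Nat.GCD using (gcd)
open import Data.Integer as ℤ using (+_; -[1+_]; _%ℕ_)
open import Data.Empty using (⊥-elim)
open import Data.Sum using (_⊎_; inj₁; inj₂)
open import Data.Product.Properties using (×-≡,≡→≡; ×-≡,≡←≡)
open import Data.Product.Function.NonDependent.Propositional using (_×-⇔_)
open import Function.Base using (_∘_)
open import Function.Bundles using (_⇔_; mk⇔; Equivalence)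
open import Function.Properties.Equivalence using () renaming (trans to ⇔-trans)
open import Relation.Binary.PropositionalEquality
open ≡-Reasoning

[m+n]%o≡m⇒o∣n : ∀ {m n o} .{{_ : NonZero o}} → (m + n) % o ≡ m → o ∣ n
[m+n]%o≡m⇒o∣n {m} {n} {o} eq = divides ((m + n) / o) (+-cancelˡ-≡ m n _ (begin
  m + n                          ≡⟨ m≡m%n+[m/n]*n (m + n) o ⟩
  (m + n) % o + (m + n) / o * o  ≡⟨ cong (_+ (m + n) / o * o) eq ⟩
  m + (m + n) / o * o            ∎))

m%o≡o∸n⇒o∣m+n : ∀ m {n o} .{{_ : NonZero o}} → n ≤ o → m % o ≡ o ∸ n → o ∣ m + n
m%o≡o∸n⇒o∣m+n m {n} {o} n≤o eq =
  subst (o ∣_) (sym m+n≡o+q*o) (∣m∣n⇒∣m+n ∣-refl (n∣m*n (m / o)))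
  where
  m+n≡o+q*o : m + n ≡ o + m / o * o
  m+n≡o+q*o = begin
    m + n                    ≡⟨ cong (_+ n) (m≡m%n+[m/n]*n m o) ⟩
    m % o + m / o * o + n    ≡⟨ +-assoc (m % o) _ n ⟩
    m % o + (m / o * o + n)  ≡⟨ cong (_+_ (m % o)) (+-comm _ n) ⟩
    m % o + (n + m / o * o)  ≡⟨ +-assoc (m % o) n _ ⟨
    m % o + n + m / o * o    ≡⟨ cong (λ r → r + n + m / o * o) eq ⟩
    o ∸ n + n + m / o * o    ≡⟨ cong (_+ m / o * o) (m∸n+n≡m n≤o) ⟩
    o + m / o * o            ∎

*-lcm-least : ∀ c {a b k} .{{_ : NonZero c}} → c * a ∣ k → c * b ∣ k → c * lcm a b ∣ k
*-lcm-least c {a} ca∣k cb∣k with ∣-trans (m∣m*n {c} a) ca∣k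
... | divides h refl rewrite *-comm h c =
  *-monoʳ-∣ c (lcm-least (*-cancelˡ-∣ c ca∣k) (*-cancelˡ-∣ c cb∣k))

*-lcm-∣⇔ : ∀ c a b {k} .{{_ : NonZero c}} → (c * a ∣ k × c * b ∣ k) ⇔ c * lcm a b ∣ k
*-lcm-∣⇔ c a b = mk⇔
  (λ (ca∣k , cb∣k) → *-lcm-least c ca∣k cb∣k)
  (λ cl∣k → ∣-trans (*-monoʳ-∣ c (m∣lcm[m,n] a b)) cl∣k
          , ∣-trans (*-monoʳ-∣ c (n∣lcm[m,n] a b)) cl∣k)

lcm-nonZero : ∀ m n .{{_ : NonZero m}} .{{_ : NonZero n}} → NonZero (lcm m n)
lcm-nonZero m n = m*n≢0⇒n≢0 (gcd m n) {{subst NonZero (sym (gcd*lcm m n)) (m*n≢0 m n)}}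

ClosesAt : (m : ℕ) → .{{NonZero m}} → ℕ → ℕ → Set
ClosesAt m k x = f m (+ k) x ≡ x × f m (+ k ℤ.- + 1) x ≡ f m (ℤ.- + 1) x

closes⇔closesAt : ∀ {m₁ m₂} .{{_ : NonZero m₁}} .{{_ : NonZero m₂}} {k x₁ x₂} →
  Closes m₁ m₂ k (x₁ , x₂) ⇔ (ClosesAt m₁ k x₁ × ClosesAt m₂ k x₂)
closes⇔closesAt = mk⇔
  (λ (e , e′) → let (e₁ , e₂) = ×-≡,≡←≡ e ; (e′₁ , e′₂) = ×-≡,≡←≡ e′ in (e₁ , e′₁) , (e₂ , e′₂))
  (λ ((e₁ , e′₁) , (e₂ , e′₂)) → ×-≡,≡→≡ (e₁ , e₂) , ×-≡,≡→≡ (e′₁ , e′₂))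

module TriangleWave (j : ℕ) where

  m : ℕ
  m = suc j

  2m : ℕ
  2m = 2 * m

  2m≡m+m : 2m ≡ m + m
  2m≡m+m = cong (_+_ m) (+-identityʳ m)

  m<2m : m < 2m
  m<2m = subst (m <_) (sym 2m≡m+m) (m<m+n m z<s)

  2m∸m≡m : 2m ∸ m ≡ m
  2m∸m≡m = trans (cong (_∸ m) 2m≡m+m) (m+n∸m≡n m m)

  ≤m⇒≤2m : ∀ {x} → x ≤ m → x ≤ 2m
  ≤m⇒≤2m x≤m = ≤-trans x≤m (<⇒≤ m<2m)

  ≤m⇒≤2m∸ : ∀ {x} → x ≤ m → x ≤ 2m ∸ x
  ≤m⇒≤2m∸ {x} x≤m = ≤-trans x≤m (subst (_≤ 2m ∸ x) 2m∸m≡m (∸-monoʳ-≤ 2m x≤m))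

  φ-periodic : ∀ a {k} → 2m ∣ k → φ m (+ (a + k)) ≡ φ m (+ a)
  φ-periodic a (divides t refl) = cong (λ r → r ⊓ (2m ∸ r)) ([m+kn]%n≡m%n a t 2m)

  φ-id : ∀ {x} → x ≤ m → φ m (+ x) ≡ x
  φ-id x≤m rewrite m<n⇒m%n≡m (≤-<-trans x≤m m<2m) = m≤n⇒m⊓n≡m (≤m⇒≤2m∸ x≤m)

  φ-mirror : ∀ {y} → 0 < y → y ≤ m → φ m (+ (2m ∸ y)) ≡ y
  φ-mirror {y} 0<y y≤m
    rewrite m<n⇒m%n≡m (∸-monoʳ-< 0<y (≤m⇒≤2m y≤m)) | m∸[m∸n]≡n (≤m⇒≤2m y≤m) =
    m≥n⇒m⊓n≡n (≤m⇒≤2m∸ y≤m)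

  φ-neg : ∀ s {y} → 0 < y → y ≤ m → 2m ∣ s + y → φ m (+ s) ≡ y
  φ-neg s {y} 0<y y≤m 2m∣s+y = begin
    φ m (+ s)                      ≡⟨ φ-periodic s ∣-refl ⟨
    φ m (+ (s + 2m))               ≡⟨ cong (φ m ∘ +_) s+2m≡ ⟩
    φ m (+ (2m ∸ y + (s + y)))     ≡⟨ φ-periodic (2m ∸ y) 2m∣s+y ⟩
    φ m (+ (2m ∸ y))               ≡⟨ φ-mirror 0<y y≤m ⟩
    y                              ∎
    where
    s+2m≡ : s + 2m ≡ 2m ∸ y + (s + y)
    s+2m≡ = begin
      s + 2m                ≡⟨ cong (_+_ s) (m+[n∸m]≡n (≤m⇒≤2m y≤m)) ⟨
      s + (y + (2m ∸ y))    ≡⟨ +-assoc s y _ ⟨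
      s + y + (2m ∸ y)      ≡⟨ +-comm (s + y) _ ⟩
      2m ∸ y + (s + y)      ∎

  φ-[-1] : φ m (ℤ.- + 1) ≡ 1
  φ-[-1] = trans (cong (λ r → r ⊓ (2m ∸ r)) -1%ℕ2m) (φ-mirror z<s (s≤s z≤n))
    where
    -1%ℕ2m : -[1+ 0 ] %ℕ 2m ≡ (2m ∸ 1) % 2m
    -1%ℕ2m rewrite m<n⇒m%n≡m (≤-<-trans (s≤s z≤n) m<2m) =
      sym (m<n⇒m%n≡m (∸-monoʳ-< z<s (<⇒≤ (≤-<-trans (s≤s z≤n) m<2m))))

  φ-fibre : ∀ a → a % 2m ≡ φ m (+ a) ⊎ a % 2m ≡ 2m ∸ φ m (+ a)
  φ-fibre a with ⊓-sel (a % 2m) (2m ∸ a % 2m)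
  ... | inj₁ eq = inj₁ (sym eq)
  ... | inj₂ eq = inj₂ (begin
    a % 2m                  ≡⟨ m∸[m∸n]≡n (m%n≤n a 2m) ⟨
    2m ∸ (2m ∸ a % 2m)      ≡⟨ cong (2m ∸_) eq ⟨
    2m ∸ φ m (+ a)          ∎)

  ∣⇒returns : ∀ {x k} → 2m ∣ k → f m (+ k ℤ.- + 1) x ≡ f m (ℤ.- + 1) x
  ∣⇒returns {k = zero} _ = refl
  ∣⇒returns {zero} {suc k} 2m∣1+k =
    trans (φ-neg k z<s (s≤s z≤n) (subst (2m ∣_) (+-comm 1 k) 2m∣1+k)) (sym φ-[-1])
  ∣⇒returns {suc x} {suc k} 2m∣1+k =
    trans (cong (φ m ∘ +_) (sym (+-suc x k))) (φ-periodic x 2m∣1+k)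

  ∣⇒closesAt : ∀ {x k} → x ≤ m → 2m ∣ k → ClosesAt m k x
  ∣⇒closesAt {x} x≤m 2m∣k = trans (φ-periodic x 2m∣k) (φ-id x≤m) , ∣⇒returns 2m∣k

  -- At the residue 2m − x the beam is heading towards 0, so one step earlier it was
  -- at x + 1, whereas a closed path must have come from x − 1.
  mirror⇒¬returns : ∀ {x k} → x < m → (x + suc k) % 2m ≡ 2m ∸ x →
    f m (+ suc k ℤ.- + 1) x ≢ f m (ℤ.- + 1) x
  mirror⇒¬returns {zero} {k} _ r≡2m _ = <-irrefl r≡2m (m%n<n (suc k) 2m)
  mirror⇒¬returns {suc x} {k} x<m r≡2m∸x returns = m≢1+n+m x (begin
    x                       ≡⟨ φ-id (≤-trans (n≤1+n x) (<⇒≤ x<m)) ⟨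
    φ m (+ x)               ≡⟨ returns ⟨
    φ m (+ (suc x + k))     ≡⟨ φ-neg (suc x + k) z<s x<m 2m∣[1+x+k]+[2+x] ⟩
    suc (suc x)             ∎)
    where
    shift : suc x + suc k + suc x ≡ suc x + k + suc (suc x)
    shift = cong suc (trans (cong (_+ suc x) (+-suc x k)) (sym (+-suc (x + k) (suc x))))

    2m∣[1+x+k]+[2+x] : 2m ∣ suc x + k + suc (suc x)
    2m∣[1+x+k]+[2+x] =
      subst (2m ∣_) shift (m%o≡o∸n⇒o∣m+n (suc x + suc k) (≤m⇒≤2m (<⇒≤ x<m)) r≡2m∸x)

  closesAt⇒∣ : ∀ {x k} → x ≤ m → ClosesAt m k x → 2m ∣ k
  closesAt⇒∣ {k = zero} _ _ = 2m ∣0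
  closesAt⇒∣ {x} {suc k} x≤m (φ≡x , returns) with φ-fibre (x + suc k) | m≤n⇒m<n∨m≡n x≤m
  ... | inj₁ r≡φ | _ = [m+n]%o≡m⇒o∣n (trans r≡φ φ≡x)
  ... | inj₂ r≡2m∸φ | inj₂ refl =
    [m+n]%o≡m⇒o∣n (trans r≡2m∸φ (trans (cong (2m ∸_) φ≡x) 2m∸m≡m))
  ... | inj₂ r≡2m∸φ | inj₁ x<m =
    ⊥-elim (mirror⇒¬returns x<m (trans r≡2m∸φ (cong (2m ∸_) φ≡x)) returns)

  closesAt⇔∣ : ∀ {x k} → x ≤ m → ClosesAt m k x ⇔ 2m ∣ k
  closesAt⇔∣ x≤m = mk⇔ (closesAt⇒∣ x≤m) (∣⇒closesAt x≤m)

isStepLength-∣ : ∀ {m₁ m₂} .{{_ : NonZero m₁}} .{{_ : NonZero m₂}} {d p} → 0 < d →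
  (∀ {k} → Closes m₁ m₂ k p ⇔ d ∣ k) → IsStepLength m₁ m₂ d p
isStepLength-∣ 0<d closes⇔∣ = 0<d , Equivalence.from closes⇔∣ ∣-refl ,
  λ j 0<j closes → ∣⇒≤ {{>-nonZero 0<j}} (Equivalence.to closes⇔∣ closes)

theorem3p10 : (m₁ m₂ : ℕ) → .{{_ : NonZero m₁}} → .{{_ : NonZero m₂}} →
    (x₁ x₂ : ℕ) → InS2 m₁ m₂ (x₁ , x₂) →
    IsStepLength m₁ m₂ (2 * lcm m₁ m₂) (x₁ , x₂)
theorem3p10 zero _ {{()}}
theorem3p10 _ zero {{_}} {{()}}
theorem3p10 m₁@(suc a) m₂@(suc b) x₁ x₂ (x₁≤m₁ , x₂≤m₂) = isStepLength-∣ 0<2lcm closes⇔2lcm∣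
  where
  closes⇔2lcm∣ : ∀ {k} → Closes m₁ m₂ k (x₁ , x₂) ⇔ 2 * lcm m₁ m₂ ∣ k
  closes⇔2lcm∣ = ⇔-trans closes⇔closesAt (⇔-trans
    (TriangleWave.closesAt⇔∣ a x₁≤m₁ ×-⇔ TriangleWave.closesAt⇔∣ b x₂≤m₂)
    (*-lcm-∣⇔ 2 m₁ m₂))

  0<2lcm : 0 < 2 * lcm m₁ m₂
  0<2lcm = >-nonZero⁻¹ (2 * lcm m₁ m₂) {{m*n≢0 2 (lcm m₁ m₂) {{_}} {{lcm-nonZero m₁ m₂}}}}
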